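{- Let $G$ and $G^*$ be graphs on the same vertex set $V=\{v_1,\dots,v_n\}$ with adjacency matrices $A$ and $A^*$, and let $S,S^*\subseteq V$ be non-empty with $W^S_G=W^{S^*}_{G^*}$. If this walk matrix has rank $n$, then $A=A^*$. (That is, a walk matrix of rank $n$ determines the adjacency matrix.)
   Context: Graphs are finite, simple, undirected. For a graph $G$ with vertex set $V=\{v_1,\dots,v_n\}$, adjacency matrix $A$, and non-empty $S\subseteq V$ with characteristic vector ${\rm e}\in\{0,1\}^n$, the walk matrix is $W^S_G=[{\rm e},A{\rm e},\dots,A^{n-1}{\rm e}]$. -}

module Defs where

open import Data.Nat using (ℕ; zero; suc)
open import Data.Fin using (Fin; zero; suc)
open import Data.Bool using (Bool; true; false; if_then_else_)
open import Data.Rational using (ℚ; 0ℚ; 1ℚ; _+_; _*_)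
open import Data.Fin.Subset using (Subset; Nonempty)
open import Data.Vec using (lookup)
open import Relation.Binary.PropositionalEquality using (_≡_)

record Graph (n : ℕ) : Set where
  field
    adj       : Fin n → Fin n → Bool
    adj-sym   : ∀ i j → adj i j ≡ adj j i
    adj-irrefl : ∀ i → adj i i ≡ false
open Graph public

Matrix : ℕ → ℕ → Set
Matrix m k = Fin m → Fin k → ℚ

Vector : ℕ → Set
Vector m = Fin m → ℚ

sumℚ : ∀ {n} → (Fin n → ℚ) → ℚ
sumℚ {zero}  f = 0ℚ
sumℚ {suc n} f = f zero + sumℚ (λ i → f (suc i))

adjMatrix : ∀ {n} → Graph n → Matrix n n
adjMatrix G i j = if adj G i j then 1ℚ else 0ℚ

charVec : ∀ {n} → Subset n → Vector n
charVec S i = if lookup S i then 1ℚ else 0ℚ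

_·v_ : ∀ {m k} → Matrix m k → Vector k → Vector m
(M ·v x) i = sumℚ (λ j → M i j * x j)

powApply : ∀ {n} → Matrix n n → ℕ → Vector n → Vector n
powApply A zero    x = x
powApply A (suc k) x = A ·v powApply A k x

-- Walk matrix W^S_G = [e, Ae, ..., A^{n-1} e]; entry (i , k) is (A^k e)_i.
walkMatrix : ∀ {n} → Graph n → Subset n → Matrix n n
walkMatrix G S i k = powApply (adjMatrix G) (Data.Fin.toℕ k) (charVec S) i

-- An m×k matrix has rank k (full column rank) over ℚ iff its k columns are
-- linearly independent: the only coefficient vector c with M c = 0 is c = 0.
HasFullColumnRank : ∀ {m k} → Matrix m k → Set
HasFullColumnRank M = ∀ (c : Vector _) → (∀ i → (M ·v c) i ≡ 0ℚ) → ∀ j → c j ≡ 0ℚ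

-- Let W be the common walk matrix of (G, S) and (G*, S*), with columns
-- Wₖ = Aᵏ e = A*ᵏ e*, and let D = A - A*.  For k < n - 1 we have
-- A Wₖ = W_{k+1} = A* Wₖ, so D annihilates every column of W except the last.
-- Since W has full rank it is surjective, hence every vector is a combination
-- of the columns and D = z γᵀ with z = D W_{n-1}: D has rank at most one.
-- But D is symmetric with zero diagonal, and such a rank-one matrix is zero.
module Submission where

open import Defs
open import Algebra.Bundles using (Ring)
open import Data.Bool using (if_then_else_)
open import Data.Empty using (⊥-elim)
open import Data.Fin using (Fin; zero; suc; punchIn; inject₁; fromℕ)
import Data.Fin.Properties as FinP
open import Data.Fin.Subset using (Subset; Nonempty)
open import Data.Nat using (ℕ; zero; suc; _<_; s≤s)
import Data.Nat.Properties as ℕP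
open import Data.Product using (Σ; _×_; _,_; proj₁; proj₂)
open import Data.Rational using (ℚ; 0ℚ; 1ℚ; _+_; _*_; _-_; -_; 1/_; ≢-nonZero)
import Data.Rational.Properties as ℚP
open import Data.Rational.Solver using (module +-*-Solver)
open import Data.Vec.Functional using (insertAt)
open import Data.Vec.Functional.Properties using (insertAt-lookup; insertAt-punchIn)
open import Relation.Nullary using (yes; no)
open import Relation.Binary.PropositionalEquality

open import Algebra.Properties.Semiring.Sum (Ring.semiring ℚP.+-*-ring)
  using (sum; sum-cong-≗; sum-replicate-zero; ∑-comm; sum-remove; sum-init-last;
         *-distribˡ-sum; *-distribʳ-sum; ∑-distrib-+)
open import Algebra.Properties.Ring ℚP.+-*-ring using (-1*x≈-x)
open import Algebra.Properties.Group (Ring.+-group ℚP.+-*-ring) using (x∙y⁻¹≈ε⇒x≈y)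
open +-*-Solver

sumℚ≡sum : ∀ {n} (f : Fin n → ℚ) → sumℚ f ≡ sum f
sumℚ≡sum {zero}  f = refl
sumℚ≡sum {suc n} f = cong (f zero +_) (sumℚ≡sum (λ i → f (suc i)))

sumℚ-cong : ∀ {n} {f g : Fin n → ℚ} → (∀ i → f i ≡ g i) → sumℚ f ≡ sumℚ g
sumℚ-cong {f = f} {g} f≗g = trans (sumℚ≡sum f) (trans (sum-cong-≗ f≗g) (sym (sumℚ≡sum g)))

sumℚ-zero : ∀ {n} (f : Fin n → ℚ) → (∀ i → f i ≡ 0ℚ) → sumℚ f ≡ 0ℚ
sumℚ-zero {n} f f≗0 = trans (sumℚ≡sum f) (trans (sum-cong-≗ f≗0) (sum-replicate-zero n))

sumℚ-*ˡ : ∀ {n} (x : ℚ) (f : Fin n → ℚ) → sumℚ (λ i → x * f i) ≡ x * sumℚ f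
sumℚ-*ˡ x f = trans (sumℚ≡sum (λ i → x * f i))
  (trans (sym (*-distribˡ-sum x f)) (cong (x *_) (sym (sumℚ≡sum f))))

sumℚ-*ʳ : ∀ {n} (x : ℚ) (f : Fin n → ℚ) → sumℚ (λ i → f i * x) ≡ sumℚ f * x
sumℚ-*ʳ x f = trans (sumℚ≡sum (λ i → f i * x))
  (trans (sym (*-distribʳ-sum x f)) (cong (_* x) (sym (sumℚ≡sum f))))

sumℚ-comm : ∀ {m n} (f : Fin m → Fin n → ℚ) →
  sumℚ (λ i → sumℚ (λ j → f i j)) ≡ sumℚ (λ j → sumℚ (λ i → f i j))
sumℚ-comm f = trans (nested f) (trans (∑-comm f) (sym (nested (λ j i → f i j))))
  where
  nested : ∀ {m n} (g : Fin m → Fin n → ℚ) → sumℚ (λ i → sumℚ (g i)) ≡ sum (λ i → sum (g i))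
  nested g = trans (sumℚ≡sum (λ i → sumℚ (g i))) (sum-cong-≗ (λ i → sumℚ≡sum (g i)))

sumℚ-remove : ∀ {n} (p : Fin (suc n)) (f : Fin (suc n) → ℚ) →
  sumℚ f ≡ f p + sumℚ (λ q → f (punchIn p q))
sumℚ-remove p f = trans (sumℚ≡sum f)
  (trans (sum-remove {i = p} f) (cong (f p +_) (sym (sumℚ≡sum (λ q → f (punchIn p q))))))

sumℚ-last : ∀ {n} (f : Fin (suc n) → ℚ) → sumℚ f ≡ sumℚ (λ k → f (inject₁ k)) + f (fromℕ n)
sumℚ-last {n} f = trans (sumℚ≡sum f)
  (trans (sum-init-last f) (cong (_+ f (fromℕ n)) (sym (sumℚ≡sum (λ k → f (inject₁ k))))))

sumℚ-- : ∀ {n} (f g : Fin n → ℚ) → sumℚ (λ i → f i - g i) ≡ sumℚ f - sumℚ g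
sumℚ-- f g = begin
  sumℚ (λ i → f i - g i)                   ≡⟨ sumℚ≡sum (λ i → f i - g i) ⟩
  sum (λ i → f i - g i)                    ≡⟨ ∑-distrib-+ f (λ i → - g i) ⟩
  sum f + sum (λ i → - g i)                ≡⟨ cong (sum f +_) (sum-cong-≗ (λ i → sym (-1*x≈-x (g i)))) ⟩
  sum f + sum (λ i → - 1ℚ * g i)           ≡⟨ cong (sum f +_) (sym (*-distribˡ-sum (- 1ℚ) g)) ⟩
  sum f + - 1ℚ * sum g                     ≡⟨ cong (sum f +_) (-1*x≈-x (sum g)) ⟩
  sum f - sum g                            ≡⟨ sym (cong₂ _-_ (sumℚ≡sum f) (sumℚ≡sum g)) ⟩
  sumℚ f - sumℚ g                          ∎
  where open ≡-Reasoning

LinearlyDependent : ∀ {m n} → (Fin m → Vector n) → Set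
LinearlyDependent {m} v = Σ (Vector m) λ c →
  (∀ i → sumℚ (λ k → c k * v k i) ≡ 0ℚ) × Σ (Fin m) λ k → c k ≢ 0ℚ

-- Gaussian elimination step: a combination c' of the reduced vectors
-- v_{punchIn p q} - a_q v_p is a combination of the original vectors, whose
-- pivot coefficient is -Σ_q c'_q a_q.
pivot-combination : ∀ {m n} (v : Fin (suc m) → Vector n) (p : Fin (suc m)) (a c' : Vector m) i →
  sumℚ (λ k → insertAt c' p (- sumℚ (λ q → c' q * a q)) k * v k i)
    ≡ sumℚ (λ q → c' q * (v (punchIn p q) i - a q * v p i))
pivot-combination v p a c' i = begin
  sumℚ (λ k → c k * v k i)
    ≡⟨ sumℚ-remove p (λ k → c k * v k i) ⟩
  c p * v p i + sumℚ (λ q → c (punchIn p q) * v (punchIn p q) i)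
    ≡⟨ cong₂ _+_ (cong (_* v p i) (insertAt-lookup c' p (- S)))
                 (sumℚ-cong (λ q → cong (_* v (punchIn p q) i) (insertAt-punchIn c' p (- S) q))) ⟩
  - S * v p i + T
    ≡⟨ solve 3 (λ s x t → (:- s) :* x :+ t := t :- s :* x) refl S (v p i) T ⟩
  T - S * v p i
    ≡⟨ cong (λ t → T - t) (sym (sumℚ-*ʳ (v p i) (λ q → c' q * a q))) ⟩
  T - sumℚ (λ q → c' q * a q * v p i)
    ≡⟨ sym (sumℚ-- (λ q → c' q * v (punchIn p q) i) (λ q → c' q * a q * v p i)) ⟩
  sumℚ (λ q → c' q * v (punchIn p q) i - c' q * a q * v p i)
    ≡⟨ sumℚ-cong (λ q → solve 4 (λ c x b y → c :* x :- c :* b :* y := c :* (x :- b :* y))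
                                 refl (c' q) (v (punchIn p q) i) (a q) (v p i)) ⟩
  sumℚ (λ q → c' q * (v (punchIn p q) i - a q * v p i)) ∎
  where
  open ≡-Reasoning
  S = sumℚ (λ q → c' q * a q)
  T = sumℚ (λ q → c' q * v (punchIn p q) i)
  c = insertAt c' p (- S)

-- Induction on n:
-- if every vector has first coordinate 0, drop that coordinate; otherwise pick
-- a pivot vector v_p with v_p 0 ≠ 0, clear the first coordinate of the other m
-- vectors with it, and lift a dependence of the m reduced vectors.
steinitz : ∀ {m n} → n < m → (v : Fin m → Vector n) → LinearlyDependent v
steinitz {suc m} {zero} _ v = (λ _ → 1ℚ) , (λ ()) , zero , ℚP.1≢0
steinitz {suc m} {suc n} (s≤s n<m) v with FinP.all? (λ k → v k zero ℚP.≟ 0ℚ)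
... | yes head≡0 =
  let (c , c·v≡0 , k , cₖ≢0) = steinitz (ℕP.m<n⇒m<1+n n<m) (λ k i → v k (suc i))
  in c , (λ { zero    → sumℚ-zero _ (λ k → trans (cong (c k *_) (head≡0 k)) (ℚP.*-zeroʳ (c k)))
            ; (suc i) → c·v≡0 i })
       , k , cₖ≢0
... | no ¬head≡0 with FinP.¬∀⟶∃¬ _ _ (λ k → v k zero ℚP.≟ 0ℚ) ¬head≡0
...   | p , vₚ≢0 =
  let (c' , c'·u≡0 , q , c'q≢0) = steinitz n<m (λ q i → u q (suc i))
  in insertAt c' p (- sumℚ (λ q → c' q * a q))
     , (λ i → trans (pivot-combination v p a c' i) (combination-u c' c'·u≡0 i))
     , punchIn p q , λ cq≡0 → c'q≢0 (trans (sym (insertAt-punchIn c' p _ q)) cq≡0)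
  where
  instance _ = ≢-nonZero vₚ≢0
  a : Vector m
  a q = v (punchIn p q) zero * 1/ v p zero
  u : Fin m → Vector (suc n)
  u q i = v (punchIn p q) i - a q * v p i
  u-head≡0 : ∀ q → u q zero ≡ 0ℚ
  u-head≡0 q = begin
    x - x * 1/ y * y     ≡⟨ cong (λ t → x - t) (ℚP.*-assoc x (1/ y) y) ⟩
    x - x * (1/ y * y)   ≡⟨ cong (λ t → x - x * t) (ℚP.*-inverseˡ y) ⟩
    x - x * 1ℚ           ≡⟨ cong (λ t → x - t) (ℚP.*-identityʳ x) ⟩
    x - x                ≡⟨ ℚP.+-inverseʳ x ⟩
    0ℚ                   ∎
    where
    open ≡-Reasoning
    x = v (punchIn p q) zero
    y = v p zero
  combination-u : ∀ c' → (∀ i → sumℚ (λ q → c' q * u q (suc i)) ≡ 0ℚ) →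
    ∀ i → sumℚ (λ q → c' q * u q i) ≡ 0ℚ
  combination-u c' h zero    = sumℚ-zero _ (λ q → trans (cong (c' q *_) (u-head≡0 q)) (ℚP.*-zeroʳ (c' q)))
  combination-u c' h (suc i) = h i

·v-combination : ∀ {m k} (M : Matrix m k) x i → (M ·v x) i ≡ sumℚ (λ j → x j * M i j)
·v-combination M x i = sumℚ-cong (λ j → ℚP.*-comm (M i j) (x j))

solve-linear : ∀ x y t → (x≢0 : x ≢ 0ℚ) → x * y + t ≡ 0ℚ →
  t * - (1/ x) {{≢-nonZero x≢0}} ≡ y
solve-linear x y t x≢0 xy+t≡0 = begin
  t * - x⁻¹                          ≡⟨ solve 4 (λ x y t i → t :* (:- i) := (x :* y :+ t) :* (:- i) :+ y :* (x :* i))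
                                              refl x y t x⁻¹ ⟩
  (x * y + t) * - x⁻¹ + y * (x * x⁻¹) ≡⟨ cong₂ (λ s r → s * - x⁻¹ + y * r) xy+t≡0 (ℚP.*-inverseʳ x) ⟩
  0ℚ * - x⁻¹ + y * 1ℚ                 ≡⟨ solve 2 (λ i y → con 0ℚ :* (:- i) :+ y :* con 1ℚ := y) refl x⁻¹ y ⟩
  y                                   ∎
  where
  open ≡-Reasoning
  instance _ = ≢-nonZero x≢0
  x⁻¹ = 1/ x

vectorAndColumns : ∀ {m k} → Vector m → Matrix m k → Fin (suc k) → Vector m
vectorAndColumns b M zero    i = b i
vectorAndColumns b M (suc j) i = M i j

-- A square matrix of full column rank is surjective.  Steinitz gives a
-- dependence d₀ b + Σₖ d_{k+1} Wₖ = 0 among b and the n columns Wₖ; by full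
-- rank d₀ ≠ 0, so b = Σₖ (- d_{k+1} / d₀) Wₖ.
fullRank⇒surjective : ∀ {n} (W : Matrix n n) → HasFullColumnRank W →
  ∀ b → Σ (Vector n) λ c → ∀ i → (W ·v c) i ≡ b i
fullRank⇒surjective {n} W fullRank b
  with steinitz (ℕP.n<1+n n) (vectorAndColumns b W)
... | d , dependence , k₀ , dₖ₀≢0 with d zero ℚP.≟ 0ℚ
...   | yes d₀≡0 = ⊥-elim (dₖ₀≢0 (d≡0 k₀))
  where
  W·d≡0 : ∀ i → (W ·v (λ k → d (suc k))) i ≡ 0ℚ
  W·d≡0 i = begin
    (W ·v (λ k → d (suc k))) i                 ≡⟨ ·v-combination W (λ k → d (suc k)) i ⟩
    T                                          ≡⟨ sym (ℚP.+-identityˡ T) ⟩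
    0ℚ + T                                     ≡⟨ cong (_+ T) (sym (ℚP.*-zeroˡ (b i))) ⟩
    0ℚ * b i + T                               ≡⟨ cong (λ s → s * b i + T) (sym d₀≡0) ⟩
    d zero * b i + T                           ≡⟨ dependence i ⟩
    0ℚ                                         ∎
    where
    open ≡-Reasoning
    T = sumℚ (λ k → d (suc k) * W i k)
  d≡0 : ∀ k → d k ≡ 0ℚ
  d≡0 zero    = d₀≡0
  d≡0 (suc k) = fullRank (λ k → d (suc k)) W·d≡0 k
...   | no d₀≢0 = c , λ i → begin
    (W ·v c) i                                 ≡⟨ ·v-combination W c i ⟩
    sumℚ (λ k → - (d (suc k) * d₀⁻¹) * W i k)  ≡⟨ sumℚ-cong (λ k → solve 3 (λ x i w → (:- (x :* i)) :* w := (x :* w) :* (:- i))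
                                                                      refl (d (suc k)) d₀⁻¹ (W i k)) ⟩
    sumℚ (λ k → d (suc k) * W i k * - d₀⁻¹)    ≡⟨ sumℚ-*ʳ (- d₀⁻¹) (λ k → d (suc k) * W i k) ⟩
    sumℚ (λ k → d (suc k) * W i k) * - d₀⁻¹    ≡⟨ solve-linear (d zero) (b i) _ d₀≢0 (dependence i) ⟩
    b i                                        ∎
  where
  open ≡-Reasoning
  instance _ = ≢-nonZero d₀≢0
  d₀⁻¹ = 1/ d zero
  c : Vector n
  c k = - (d (suc k) * d₀⁻¹)

·v-difference : ∀ {m k} (M N : Matrix m k) x i →
  ((λ r j → M r j - N r j) ·v x) i ≡ (M ·v x) i - (N ·v x) i
·v-difference M N x i = trans
  (sumℚ-cong (λ j → solve 3 (λ a b y → (a :- b) :* y := a :* y :- b :* y) refl (M i j) (N i j) (x j)))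
  (sumℚ-- (λ j → M i j * x j) (λ j → N i j * x j))

unit : ∀ {n} → Fin n → Vector n
unit j i with i FinP.≟ j
... | yes _ = 1ℚ
... | no  _ = 0ℚ

unit-diagonal : ∀ {n} (j : Fin n) → unit j j ≡ 1ℚ
unit-diagonal j with j FinP.≟ j
... | yes _   = refl
... | no  j≢j = ⊥-elim (j≢j refl)

unit-off-diagonal : ∀ {n} (j i : Fin n) → i ≢ j → unit j i ≡ 0ℚ
unit-off-diagonal j i i≢j with i FinP.≟ j
... | yes i≡j = ⊥-elim (i≢j i≡j)
... | no  _   = refl

·v-unit : ∀ {m n} (M : Matrix m (suc n)) j i → (M ·v unit j) i ≡ M i j
·v-unit M j i = begin
  (M ·v unit j) i
    ≡⟨ sumℚ-remove j (λ r → M i r * unit j r) ⟩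
  M i j * unit j j + sumℚ (λ q → M i (punchIn j q) * unit j (punchIn j q))
    ≡⟨ cong₂ _+_ (cong (M i j *_) (unit-diagonal j)) (sumℚ-zero _ off-diagonal) ⟩
  M i j * 1ℚ + 0ℚ
    ≡⟨ trans (ℚP.+-identityʳ _) (ℚP.*-identityʳ (M i j)) ⟩
  M i j ∎
  where
  open ≡-Reasoning
  off-diagonal : ∀ q → M i (punchIn j q) * unit j (punchIn j q) ≡ 0ℚ
  off-diagonal q = trans (cong (M i (punchIn j q) *_) (unit-off-diagonal j _ (FinP.punchInᵢ≢i j q)))
                         (ℚP.*-zeroʳ (M i (punchIn j q)))

·v-assoc : ∀ {m k l} (D : Matrix m k) (W : Matrix k l) c i →
  (D ·v (W ·v c)) i ≡ sumℚ (λ j → (D ·v (λ r → W r j)) i * c j)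
·v-assoc D W c i = begin
  sumℚ (λ r → D i r * sumℚ (λ j → W r j * c j))
    ≡⟨ sumℚ-cong (λ r → sym (sumℚ-*ˡ (D i r) (λ j → W r j * c j))) ⟩
  sumℚ (λ r → sumℚ (λ j → D i r * (W r j * c j)))
    ≡⟨ sumℚ-comm (λ r j → D i r * (W r j * c j)) ⟩
  sumℚ (λ j → sumℚ (λ r → D i r * (W r j * c j)))
    ≡⟨ sumℚ-cong (λ j → trans (sumℚ-cong (λ r → sym (ℚP.*-assoc (D i r) (W r j) (c j))))
                              (sumℚ-*ʳ (c j) (λ r → D i r * W r j))) ⟩
  sumℚ (λ j → (D ·v (λ r → W r j)) i * c j) ∎
  where open ≡-Reasoning

-- If D annihilates every column of W but the last one, and W is surjective,
-- then D has rank at most one: D = z γᵀ with z = D (last column of W).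
-- (Write the j-th basis vector as W c; then D eⱼ = cₙ z.)
rankOne-of-vanishing-columns : ∀ {n} (D W : Matrix (suc n) (suc n)) →
  (∀ b → Σ (Vector (suc n)) λ c → ∀ i → (W ·v c) i ≡ b i) →
  (∀ (k : Fin n) i → (D ·v (λ r → W r (inject₁ k))) i ≡ 0ℚ) →
  Σ (Vector (suc n)) λ γ → ∀ i j → D i j ≡ (D ·v (λ r → W r (fromℕ n))) i * γ j
rankOne-of-vanishing-columns {n} D W surjective vanishing =
  (λ j → proj₁ (surjective (unit j)) (fromℕ n)) , factor
  where
  z = D ·v (λ r → W r (fromℕ n))
  factor : ∀ i j → D i j ≡ z i * proj₁ (surjective (unit j)) (fromℕ n)
  factor i j = begin
    D i j                                         ≡⟨ sym (·v-unit D j i) ⟩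
    (D ·v unit j) i                               ≡⟨ sumℚ-cong (λ r → cong (D i r *_) (sym (W·c≡eⱼ r))) ⟩
    (D ·v (W ·v c)) i                             ≡⟨ ·v-assoc D W c i ⟩
    sumℚ (λ k → (D ·v (λ r → W r k)) i * c k)     ≡⟨ sumℚ-last (λ k → (D ·v (λ r → W r k)) i * c k) ⟩
    sumℚ (λ k → (D ·v (λ r → W r (inject₁ k))) i * c (inject₁ k)) + z i * c (fromℕ n)
      ≡⟨ cong (_+ z i * c (fromℕ n)) (sumℚ-zero _ (λ k →
           trans (cong (_* c (inject₁ k)) (vanishing k i)) (ℚP.*-zeroˡ (c (inject₁ k))))) ⟩
    0ℚ + z i * c (fromℕ n)                        ≡⟨ ℚP.+-identityˡ _ ⟩
    z i * c (fromℕ n)                             ∎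
    where
    open ≡-Reasoning
    c = proj₁ (surjective (unit j))
    W·c≡eⱼ = proj₂ (surjective (unit j))

cancel-nonzero : ∀ x y → x ≢ 0ℚ → x * y ≡ 0ℚ → y ≡ 0ℚ
cancel-nonzero x y x≢0 xy≡0 = begin
  y                ≡⟨ sym (ℚP.*-identityˡ y) ⟩
  1ℚ * y           ≡⟨ cong (_* y) (sym (ℚP.*-inverseˡ x)) ⟩
  (1/ x * x) * y   ≡⟨ ℚP.*-assoc (1/ x) x y ⟩
  1/ x * (x * y)   ≡⟨ cong (1/ x *_) xy≡0 ⟩
  1/ x * 0ℚ        ≡⟨ ℚP.*-zeroʳ (1/ x) ⟩
  0ℚ               ∎
  where
  open ≡-Reasoning
  instance _ = ≢-nonZero x≢0

-- A symmetric matrix with zero diagonal and rank at most one vanishes: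
-- if D = z γᵀ and zᵢ ≠ 0, then Dᵢᵢ = 0 forces γᵢ = 0, so Dᵢⱼ = Dⱼᵢ = zⱼ γᵢ = 0.
rankOne-symmetric-hollow⇒zero : ∀ {n} (D : Matrix n n) (z γ : Vector n) →
  (∀ i j → D i j ≡ z i * γ j) → (∀ i j → D i j ≡ D j i) → (∀ i → D i i ≡ 0ℚ) →
  ∀ i j → D i j ≡ 0ℚ
rankOne-symmetric-hollow⇒zero D z γ D≡zγ symmetric hollow i j with z i ℚP.≟ 0ℚ
... | yes zᵢ≡0 = trans (D≡zγ i j) (trans (cong (_* γ j) zᵢ≡0) (ℚP.*-zeroˡ (γ j)))
... | no  zᵢ≢0 = begin
  D i j      ≡⟨ symmetric i j ⟩
  D j i      ≡⟨ D≡zγ j i ⟩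
  z j * γ i  ≡⟨ cong (z j *_) γᵢ≡0 ⟩
  z j * 0ℚ   ≡⟨ ℚP.*-zeroʳ (z j) ⟩
  0ℚ         ∎
  where
  open ≡-Reasoning
  γᵢ≡0 : γ i ≡ 0ℚ
  γᵢ≡0 = cancel-nonzero (z i) (γ i) zᵢ≢0 (trans (sym (D≡zγ i i)) (hollow i))

adjDifference : ∀ {n} → Graph n → Graph n → Matrix n n
adjDifference G G* i j = adjMatrix G i j - adjMatrix G* i j

adjDifference-symmetric : ∀ {n} (G G* : Graph n) i j → adjDifference G G* i j ≡ adjDifference G G* j i
adjDifference-symmetric G G* i j = cong₂ _-_ (adjMatrix-symmetric G) (adjMatrix-symmetric G*)
  where
  adjMatrix-symmetric : ∀ H → adjMatrix H i j ≡ adjMatrix H j i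
  adjMatrix-symmetric H = cong (λ e → if e then 1ℚ else 0ℚ) (adj-sym H i j)

adjDifference-hollow : ∀ {n} (G G* : Graph n) i → adjDifference G G* i i ≡ 0ℚ
adjDifference-hollow G G* i =
  trans (cong₂ _-_ (adjMatrix-hollow G) (adjMatrix-hollow G*)) (ℚP.+-inverseʳ 0ℚ)
  where
  adjMatrix-hollow : ∀ H → adjMatrix H i i ≡ 0ℚ
  adjMatrix-hollow H = cong (λ e → if e then 1ℚ else 0ℚ) (adj-irrefl H i)

walk-step : ∀ {n} (G : Graph (suc n)) S (k : Fin n) i →
  (adjMatrix G ·v (λ r → walkMatrix G S r (inject₁ k))) i ≡ walkMatrix G S i (suc k)
walk-step G S k i =
  cong (λ t → powApply (adjMatrix G) (suc t) (charVec S) i) (FinP.toℕ-inject₁ k)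

-- If two graphs have the same walk matrix W, then A - A* annihilates every
-- column of W but the last: A Wₖ = W_{k+1} = A* Wₖ.
sameWalks⇒difference-annihilates : ∀ {n} (G G* : Graph (suc n)) S S* →
  (∀ i k → walkMatrix G S i k ≡ walkMatrix G* S* i k) →
  ∀ (k : Fin n) i → (adjDifference G G* ·v (λ r → walkMatrix G S r (inject₁ k))) i ≡ 0ℚ
sameWalks⇒difference-annihilates G G* S S* sameWalks k i = begin
  (adjDifference G G* ·v Wₖ) i                 ≡⟨ ·v-difference A A* Wₖ i ⟩
  (A ·v Wₖ) i - (A* ·v Wₖ) i                   ≡⟨ cong (λ t → (A ·v Wₖ) i - t)
                                                       (sumℚ-cong (λ r → cong (A* i r *_) (sameWalks r (inject₁ k)))) ⟩
  (A ·v Wₖ) i - (A* ·v W*ₖ) i                  ≡⟨ cong₂ _-_ (walk-step G S k i) (walk-step G* S* k i) ⟩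
  walkMatrix G S i (suc k) - walkMatrix G* S* i (suc k)
                                               ≡⟨ cong (λ t → t - walkMatrix G* S* i (suc k)) (sameWalks i (suc k)) ⟩
  walkMatrix G* S* i (suc k) - walkMatrix G* S* i (suc k)
                                               ≡⟨ ℚP.+-inverseʳ (walkMatrix G* S* i (suc k)) ⟩
  0ℚ                                           ∎
  where
  open ≡-Reasoning
  A  = adjMatrix G
  A* = adjMatrix G*
  Wₖ  = λ r → walkMatrix G S r (inject₁ k)
  W*ₖ = λ r → walkMatrix G* S* r (inject₁ k)

theorem5p1 : (n : ℕ) (G G* : Graph n) (S S* : Subset n) →
    Nonempty S → Nonempty S* →
    (∀ i k → walkMatrix G S i k ≡ walkMatrix G* S* i k) →
    HasFullColumnRank (walkMatrix G S) →
    ∀ i j → adjMatrix G i j ≡ adjMatrix G* i j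
theorem5p1 zero    G G* S S* _ _ sameWalks fullRank ()
theorem5p1 (suc n) G G* S S* _ _ sameWalks fullRank i j =
  x∙y⁻¹≈ε⇒x≈y (adjMatrix G i j) (adjMatrix G* i j)
    (rankOne-symmetric-hollow⇒zero D z (proj₁ factorization) (proj₂ factorization)
      (adjDifference-symmetric G G*) (adjDifference-hollow G G*) i j)
  where
  W = walkMatrix G S
  D = adjDifference G G*
  z = D ·v (λ r → W r (fromℕ n))
  factorization : Σ (Vector (suc n)) λ γ → ∀ r s → D r s ≡ z r * γ s
  factorization = rankOne-of-vanishing-columns D W (fullRank⇒surjective W fullRank)
                    (sameWalks⇒difference-annihilates G G* S S* sameWalks)
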